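{- The cut rule is admissible in $\mathsf{GWF_N}$: for all finite multisets $\Gamma,\Gamma',\Delta,\Delta'$ of formulas and every formula $D$, if $\Gamma\Rightarrow D,\Delta$ and $D,\Gamma'\Rightarrow\Delta'$ are both derivable in $\mathsf{GWF_N}$, then $\Gamma,\Gamma'\Rightarrow\Delta,\Delta'$ is derivable in $\mathsf{GWF_N}$.
   Context: Formulas are built from a countable set of propositional atoms and the constant $\bot$ using $\wedge,\vee,\rightarrow$. Sequents are $\Gamma\Rightarrow\Delta$ with $\Gamma,\Delta$ finite, possibly empty, multisets of formulas. The calculus $\mathsf{GWF_N}$ has the rules ($p$ atomic, $\Gamma,\Delta$ arbitrary): (Ax) $p,\Gamma\Rightarrow\Delta,p$; ($\bot_L$) $\bot,\Gamma\Rightarrow\Delta$; ($\wedge_L$) from $A,B,\Gamma\Rightarrow\Delta$ infer $A\wedge B,\Gamma\Rightarrow\Delta$; ($\wedge_R$) from $\Gamma\Rightarrow\Delta,A$ and $\Gamma\Rightarrow\Delta,B$ infer $\Gamma\Rightarrow\Delta,A\wedge B$; ($\vee_L$) from $A,\Gamma\Rightarrow\Delta$ and $B,\Gamma\Rightarrow\Delta$ infer $A\vee B,\Gamma\Rightarrow\Delta$; ($\vee_R$) from $\Gamma\Rightarrow\Delta,A,B$ infer $\Gamma\Rightarrow\Delta,A\vee B$; ($\rightarrow_R$) from $A\Rightarrow B$ infer $\Gamma\Rightarrow A\rightarrow B,\Delta$; ($\rightarrow_{LR_N}$) from $A\Rightarrow C,B$; $A,D\Rightarrow B$; $C\Rightarrow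 A,D$; $C,B\Rightarrow D$ infer $\Gamma,C\rightarrow D\Rightarrow A\rightarrow B,\Delta$. (That is, $\mathsf{GWF_N}$ is $\mathsf{GWF}$ with its rule $\rightarrow_{LR}$ replaced by $\rightarrow_{LR_N}$.) Derivability is derivability using only these rules, without cut. -}

module Defs where

open import Data.Nat using (ℕ)
open import Data.List using (List; []; _∷_; _++_)
open import Data.List.Relation.Binary.Permutation.Propositional using (_↭_)

data Formula : Set where
  atom : ℕ → Formula
  ⊥'   : Formula
  _∧'_ : Formula → Formula → Formula
  _∨'_ : Formula → Formula → Formula
  _⇒'_ : Formula → Formula → Formula

infixr 6 _∧'_
infixr 5 _∨'_
infixr 4 _⇒'_

-- Finite multisets of formulas are represented by lists; lists that are
-- permutations of each other denote the same multiset.  Every rule below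
-- therefore has as conclusion ANY pair of lists permutation-equivalent to
-- the displayed conclusion, so derivability only depends on the
-- underlying multisets.
data GWF_N : List Formula → List Formula → Set where
  ax   : ∀ {Γ Δ Γ₀ Δ₀} (p : ℕ) →
         Γ ↭ (atom p ∷ Γ₀) → Δ ↭ (atom p ∷ Δ₀) → GWF_N Γ Δ
  ⊥L   : ∀ {Γ Δ Γ₀} → Γ ↭ (⊥' ∷ Γ₀) → GWF_N Γ Δ
  ∧L   : ∀ {Γ Δ Γ₀ A B} → Γ ↭ ((A ∧' B) ∷ Γ₀) →
         GWF_N (A ∷ B ∷ Γ₀) Δ → GWF_N Γ Δ
  ∧R   : ∀ {Γ Δ Δ₀ A B} → Δ ↭ ((A ∧' B) ∷ Δ₀) →
         GWF_N Γ (A ∷ Δ₀) → GWF_N Γ (B ∷ Δ₀) → GWF_N Γ Δ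
  ∨L   : ∀ {Γ Δ Γ₀ A B} → Γ ↭ ((A ∨' B) ∷ Γ₀) →
         GWF_N (A ∷ Γ₀) Δ → GWF_N (B ∷ Γ₀) Δ → GWF_N Γ Δ
  ∨R   : ∀ {Γ Δ Δ₀ A B} → Δ ↭ ((A ∨' B) ∷ Δ₀) →
         GWF_N Γ (A ∷ B ∷ Δ₀) → GWF_N Γ Δ
  ⇒R   : ∀ {Γ Δ Δ₀ A B} → Δ ↭ ((A ⇒' B) ∷ Δ₀) →
         GWF_N (A ∷ []) (B ∷ []) → GWF_N Γ Δ
  ⇒LRN : ∀ {Γ Δ Γ₀ Δ₀ A B C D} →
         Γ ↭ ((C ⇒' D) ∷ Γ₀) → Δ ↭ ((A ⇒' B) ∷ Δ₀) →
         GWF_N (A ∷ []) (C ∷ B ∷ []) →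
         GWF_N (A ∷ D ∷ []) (B ∷ []) →
         GWF_N (C ∷ []) (A ∷ D ∷ []) →
         GWF_N (C ∷ B ∷ []) (D ∷ []) →
         GWF_N Γ Δ

{-# OPTIONS --safe #-}
-- Cut is proved in the context-sharing form: from Γ ⇒ D, Δ and D, Γ ⇒ Δ infer Γ ⇒ Δ; this needs
-- no contraction, and the statement follows from it by weakening.  The proof is by induction on D
-- and, inside, on the derivation of the left premise.  A rule in which D is not principal commutes
-- with the cut, the right premise being adapted by invertibility of the ∧/∨ rules.  If D is
-- principal, a conjunction or disjunction reduces to cuts on its components; for an atom the left
-- premise is an axiom, so D occurs in Γ and its extra copy is contracted away in the right premise;
-- for an implication every principal use of D in the right premise is a →LR_N step, whose four
-- premises compose with those of the left premise's last rule by cuts on the two immediate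
-- subformulas.
module Submission where

open import Data.Nat using (ℕ)
open import Data.List using (List; []; _∷_; _++_; [_])
open import Data.List.Membership.Propositional using (_∈_)
open import Data.List.Membership.Propositional.Properties using (∈-∃++)
open import Data.List.Relation.Unary.Any using (here; there)
open import Data.List.Relation.Binary.Permutation.Propositional
open import Data.List.Relation.Binary.Permutation.Propositional.Properties
  using (∈-resp-↭; drop-∷; shift; shifts; ++⁺ˡ; ++⁺ʳ; ++-comm; ++-identityʳ)
open import Data.Product using (∃-syntax; _×_; _,_; proj₂)
open import Data.Sum using (_⊎_; inj₁; inj₂)
open import Data.Unit using (⊤; tt)
open import Data.Empty using (⊥-elim)
open import Relation.Nullary using (¬_)
open import Relation.Binary.PropositionalEquality using (_≡_; refl)

open import Defs

module _ {a} {X : Set a} where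

  private
    variable
      x y : X
      xs ys zs : List X

  ↭∷⇒∈ : xs ↭ x ∷ ys → x ∈ xs
  ↭∷⇒∈ σ = ∈-resp-↭ (↭-sym σ) (here refl)

  ∈⇒↭∷ : x ∈ xs → ∃[ ys ] (xs ↭ x ∷ ys)
  ∈⇒↭∷ {x} x∈xs with us , vs , refl ← ∈-∃++ x∈xs = us ++ vs , shift x us vs

  ↭-shift : ∀ ws → xs ↭ x ∷ ys → ws ++ xs ↭ x ∷ ws ++ ys
  ↭-shift {x = x} {ys} ws σ = trans (++⁺ˡ ws σ) (shift x ws ys)

  ↭-∷-cases : xs ↭ x ∷ ys → xs ↭ y ∷ zs →
              (x ≡ y × ys ↭ zs) ⊎ ∃[ ws ] (ys ↭ y ∷ ws × zs ↭ x ∷ ws)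
  ↭-∷-cases {xs} {x} {ys} {y} {zs} σ τ with ↭∷⇒∈ (trans (↭-sym σ) τ)
  ... | here refl = inj₁ (refl , drop-∷ (trans (↭-sym σ) τ))
  ... | there y∈ys with ws , ρ ← ∈⇒↭∷ y∈ys =
    inj₂ (ws , ρ , ↭-sym (drop-∷ (begin
      y ∷ x ∷ ws  ↭⟨ swap y x refl ⟩
      x ∷ y ∷ ws  ↭⟨ prep x ρ ⟨
      x ∷ ys      ↭⟨ σ ⟨
      xs          ↭⟨ τ ⟩
      y ∷ zs      ∎)))
    where open PermutationReasoning

infix 3 _⊢_

_⊢_ : List Formula → List Formula → Set
_⊢_ = GWF_N

private
  variable
    p : ℕ
    A B C D E F N : Formula
    Γ Γ′ Γ₀ Γ₁ Γs Δ Δ′ Δ₀ Δ₁ Δs : List Formula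

exchange : Γ ⊢ Δ → Γ ↭ Γ′ → Δ ↭ Δ′ → Γ′ ⊢ Δ′
exchange (ax p g d)           σ τ = ax p (trans (↭-sym σ) g) (trans (↭-sym τ) d)
exchange (⊥L g)               σ τ = ⊥L (trans (↭-sym σ) g)
exchange (∧L g a)             σ τ = ∧L (trans (↭-sym σ) g) (exchange a refl τ)
exchange (∧R d a b)           σ τ = ∧R (trans (↭-sym τ) d) (exchange a σ refl) (exchange b σ refl)
exchange (∨L g a b)           σ τ = ∨L (trans (↭-sym σ) g) (exchange a refl τ) (exchange b refl τ)
exchange (∨R d a)             σ τ = ∨R (trans (↭-sym τ) d) (exchange a σ refl)
exchange (⇒R d a)             σ τ = ⇒R (trans (↭-sym τ) d) a
exchange (⇒LRN g d a b c e)   σ τ = ⇒LRN (trans (↭-sym σ) g) (trans (↭-sym τ) d) a b c e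

exchangeL : A ∷ B ∷ Γ ⊢ Δ → B ∷ A ∷ Γ ⊢ Δ
exchangeL {A} {B} d = exchange d (swap A B refl) refl

exchangeR : Γ ⊢ A ∷ B ∷ Δ → Γ ⊢ B ∷ A ∷ Δ
exchangeR {A = A} {B} d = exchange d refl (swap A B refl)

weaken : ∀ Γ₁ Δ₁ → Γ ⊢ Δ → Γ ++ Γ₁ ⊢ Δ ++ Δ₁
weaken Γ₁ Δ₁ (ax p g d)           = ax p (++⁺ʳ Γ₁ g) (++⁺ʳ Δ₁ d)
weaken Γ₁ Δ₁ (⊥L g)               = ⊥L (++⁺ʳ Γ₁ g)
weaken Γ₁ Δ₁ (∧L g a)             = ∧L (++⁺ʳ Γ₁ g) (weaken Γ₁ Δ₁ a)
weaken Γ₁ Δ₁ (∧R d a b)           = ∧R (++⁺ʳ Δ₁ d) (weaken Γ₁ Δ₁ a) (weaken Γ₁ Δ₁ b)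
weaken Γ₁ Δ₁ (∨L g a b)           = ∨L (++⁺ʳ Γ₁ g) (weaken Γ₁ Δ₁ a) (weaken Γ₁ Δ₁ b)
weaken Γ₁ Δ₁ (∨R d a)             = ∨R (++⁺ʳ Δ₁ d) (weaken Γ₁ Δ₁ a)
weaken Γ₁ Δ₁ (⇒R d a)             = ⇒R (++⁺ʳ Δ₁ d) a
weaken Γ₁ Δ₁ (⇒LRN g d a b c e)   = ⇒LRN (++⁺ʳ Γ₁ g) (++⁺ʳ Δ₁ d) a b c e

weakenL : ∀ A → Γ ⊢ Δ → A ∷ Γ ⊢ Δ
weakenL {Γ} {Δ} A d = exchange (weaken [ A ] [] d) (++-comm Γ [ A ]) (++-identityʳ Δ)

weakenR : ∀ A → Γ ⊢ Δ → Γ ⊢ A ∷ Δ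
weakenR {Γ} {Δ} A d = exchange (weaken [] [ A ] d) (++-identityʳ Γ) (++-comm Δ [ A ])

⇒LRN-Premises : Formula → Formula → Formula → Formula → Set
⇒LRN-Premises A B C D =
  (A ∷ [] ⊢ C ∷ B ∷ []) × (A ∷ D ∷ [] ⊢ B ∷ []) × (C ∷ [] ⊢ A ∷ D ∷ []) × (C ∷ B ∷ [] ⊢ D ∷ [])

⇒LRN-intro : Γ ↭ (C ⇒' D) ∷ Γ₀ → Δ ↭ (A ⇒' B) ∷ Δ₀ → ⇒LRN-Premises A B C D → Γ ⊢ Δ
⇒LRN-intro g d (a , b , c , e) = ⇒LRN g d a b c e

data ∧∨-Premise : List Formula → List Formula → List Formula → List Formula → Set where
  ∧L  : Γ ↭ (A ∧' B) ∷ Γ₀ → ∧∨-Premise Γ Δ (A ∷ B ∷ Γ₀) Δ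
  ∨L₁ : Γ ↭ (A ∨' B) ∷ Γ₀ → ∧∨-Premise Γ Δ (A ∷ Γ₀) Δ
  ∨L₂ : Γ ↭ (A ∨' B) ∷ Γ₀ → ∧∨-Premise Γ Δ (B ∷ Γ₀) Δ
  ∧R₁ : Δ ↭ (A ∧' B) ∷ Δ₀ → ∧∨-Premise Γ Δ Γ (A ∷ Δ₀)
  ∧R₂ : Δ ↭ (A ∧' B) ∷ Δ₀ → ∧∨-Premise Γ Δ Γ (B ∷ Δ₀)
  ∨R  : Δ ↭ (A ∨' B) ∷ Δ₀ → ∧∨-Premise Γ Δ Γ (A ∷ B ∷ Δ₀)

Stable : (List Formula → List Formula → Set) → Set
Stable K = ∀ {Γ Δ Γ′ Δ′} → ∧∨-Premise Γ Δ Γ′ Δ′ → K Γ Δ → K Γ′ Δ′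

-- The premises of a last rule with principal formula M and conclusion M, Γ ⇒ Δ (resp. Γ ⇒ M, Δ).
data LeftPrincipal : Formula → List Formula → List Formula → Set where
  ax   : Δ ↭ atom p ∷ Δ₀ → LeftPrincipal (atom p) Γ Δ
  ⊥L   : LeftPrincipal ⊥' Γ Δ
  ∧L   : A ∷ B ∷ Γ ⊢ Δ → LeftPrincipal (A ∧' B) Γ Δ
  ∨L   : A ∷ Γ ⊢ Δ → B ∷ Γ ⊢ Δ → LeftPrincipal (A ∨' B) Γ Δ
  ⇒LRN : Δ ↭ (A ⇒' B) ∷ Δ₀ → ⇒LRN-Premises A B C D → LeftPrincipal (C ⇒' D) Γ Δ

data RightPrincipal : Formula → List Formula → List Formula → Set where
  ax   : Γ ↭ atom p ∷ Γ₀ → RightPrincipal (atom p) Γ Δ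
  ∧R   : Γ ⊢ A ∷ Δ → Γ ⊢ B ∷ Δ → RightPrincipal (A ∧' B) Γ Δ
  ∨R   : Γ ⊢ A ∷ B ∷ Δ → RightPrincipal (A ∨' B) Γ Δ
  ⇒R   : A ∷ [] ⊢ B ∷ [] → RightPrincipal (A ⇒' B) Γ Δ
  ⇒LRN : Γ ↭ (C ⇒' D) ∷ Γ₀ → ⇒LRN-Premises A B C D → RightPrincipal (A ⇒' B) Γ Δ

-- An occurrence of M can be replaced by L throughout a derivation as soon as this is possible at the
-- rules where it is principal; there the invariant K of the side formulas may be used.
module _ {K : List Formula → List Formula → Set} (K-stable : Stable K)
         (M : Formula) (L : List Formula) where

  replaceL : (∀ {Γ Δ} → K Γ Δ → LeftPrincipal M Γ Δ → L ++ Γ ⊢ Δ) →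
             Γs ⊢ Δ → Γs ↭ M ∷ Γ → K Γ Δ → L ++ Γ ⊢ Δ
  replaceL principal = go
    where
    go : Γs ⊢ Δ → Γs ↭ M ∷ Γ → K Γ Δ → L ++ Γ ⊢ Δ
    go (ax p g d) e k with ↭-∷-cases e g
    ... | inj₁ (refl , _)  = principal k (ax d)
    ... | inj₂ (_ , σ , _) = ax p (↭-shift L σ) d
    go (⊥L g) e k with ↭-∷-cases e g
    ... | inj₁ (refl , _)  = principal k ⊥L
    ... | inj₂ (_ , σ , _) = ⊥L (↭-shift L σ)
    go (∧L {A = A} {B} g a) e k with ↭-∷-cases e g
    ... | inj₁ (refl , σ)  = principal k (∧L (exchange a (prep A (prep B (↭-sym σ))) refl))
    ... | inj₂ (_ , σ , τ) = ∧L (↭-shift L σ)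
      (exchange (go a (↭-shift (A ∷ B ∷ []) τ) (K-stable (∧L σ) k)) (shifts L (A ∷ B ∷ [])) refl)
    go (∨L {A = A} {B} g a b) e k with ↭-∷-cases e g
    ... | inj₁ (refl , σ)  = principal k (∨L (exchange a (prep A (↭-sym σ)) refl)
                                             (exchange b (prep B (↭-sym σ)) refl))
    ... | inj₂ (_ , σ , τ) = ∨L (↭-shift L σ)
      (exchange (go a (↭-shift [ A ] τ) (K-stable (∨L₁ σ) k)) (shifts L [ A ]) refl)
      (exchange (go b (↭-shift [ B ] τ) (K-stable (∨L₂ σ) k)) (shifts L [ B ]) refl)
    go (∧R d a b) e k = ∧R d (go a e (K-stable (∧R₁ d) k)) (go b e (K-stable (∧R₂ d) k))
    go (∨R d a) e k = ∨R d (go a e (K-stable (∨R d) k))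
    go (⇒R d a) e k = ⇒R d a
    go (⇒LRN g d a b c f) e k with ↭-∷-cases e g
    ... | inj₁ (refl , _)  = principal k (⇒LRN d (a , b , c , f))
    ... | inj₂ (_ , σ , _) = ⇒LRN (↭-shift L σ) d a b c f

  replaceR : (∀ {Γ Δ} → K Γ Δ → RightPrincipal M Γ Δ → Γ ⊢ L ++ Δ) →
             Γ ⊢ Δs → Δs ↭ M ∷ Δ → K Γ Δ → Γ ⊢ L ++ Δ
  replaceR principal = go
    where
    go : Γ ⊢ Δs → Δs ↭ M ∷ Δ → K Γ Δ → Γ ⊢ L ++ Δ
    go (ax p g d) e k with ↭-∷-cases e d
    ... | inj₁ (refl , _)  = principal k (ax g)
    ... | inj₂ (_ , σ , _) = ax p g (↭-shift L σ)
    go (⊥L g) e k = ⊥L g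
    go (∧L g a) e k = ∧L g (go a e (K-stable (∧L g) k))
    go (∨L g a b) e k = ∨L g (go a e (K-stable (∨L₁ g) k)) (go b e (K-stable (∨L₂ g) k))
    go (∧R {A = A} {B} d a b) e k with ↭-∷-cases e d
    ... | inj₁ (refl , σ)  = principal k (∧R (exchange a refl (prep A (↭-sym σ)))
                                             (exchange b refl (prep B (↭-sym σ))))
    ... | inj₂ (_ , σ , τ) = ∧R (↭-shift L σ)
      (exchange (go a (↭-shift [ A ] τ) (K-stable (∧R₁ σ) k)) refl (shifts L [ A ]))
      (exchange (go b (↭-shift [ B ] τ) (K-stable (∧R₂ σ) k)) refl (shifts L [ B ]))
    go (∨R {A = A} {B} d a) e k with ↭-∷-cases e d
    ... | inj₁ (refl , σ)  = principal k (∨R (exchange a refl (prep A (prep B (↭-sym σ)))))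
    ... | inj₂ (_ , σ , τ) = ∨R (↭-shift L σ)
      (exchange (go a (↭-shift (A ∷ B ∷ []) τ) (K-stable (∨R σ) k)) refl (shifts L (A ∷ B ∷ [])))
    go (⇒R d a) e k with ↭-∷-cases e d
    ... | inj₁ (refl , _)  = principal k (⇒R a)
    ... | inj₂ (_ , σ , _) = ⇒R (↭-shift L σ) a
    go (⇒LRN g d a b c f) e k with ↭-∷-cases e d
    ... | inj₁ (refl , _)  = principal k (⇒LRN g (a , b , c , f))
    ... | inj₂ (_ , σ , _) = ⇒LRN g (↭-shift L σ) a b c f

⊤-stable : Stable (λ _ _ → ⊤)
⊤-stable _ _ = tt

data IsConjOrDisj : Formula → Set where
  conj : IsConjOrDisj (A ∧' B)
  disj : IsConjOrDisj (A ∨' B)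

∈-stable : ¬ IsConjOrDisj N → Stable (λ Γ _ → N ∈ Γ)
∈-stable ¬cd (∧L σ) m with ∈-resp-↭ σ m
... | here refl = ⊥-elim (¬cd conj)
... | there m′  = there (there m′)
∈-stable ¬cd (∨L₁ σ) m with ∈-resp-↭ σ m
... | here refl = ⊥-elim (¬cd disj)
... | there m′  = there m′
∈-stable ¬cd (∨L₂ σ) m with ∈-resp-↭ σ m
... | here refl = ⊥-elim (¬cd disj)
... | there m′  = there m′
∈-stable ¬cd (∧R₁ _) m = m
∈-stable ¬cd (∧R₂ _) m = m
∈-stable ¬cd (∨R _)  m = m

invert : ∀ Π → Π ++ Γ ⊢ Δ → ∧∨-Premise Γ Δ Γ′ Δ′ → Π ++ Γ′ ⊢ Δ′
invert Π d (∧L {A = A} {B} σ) = exchange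
  (replaceL ⊤-stable (A ∧' B) (A ∷ B ∷ []) (λ { _ (∧L a) → a }) d (↭-shift Π σ) tt)
  (shifts (A ∷ B ∷ []) Π) refl
invert Π d (∨L₁ {A = A} {B} σ) = exchange
  (replaceL ⊤-stable (A ∨' B) [ A ] (λ { _ (∨L a _) → a }) d (↭-shift Π σ) tt)
  (shifts [ A ] Π) refl
invert Π d (∨L₂ {A = A} {B} σ) = exchange
  (replaceL ⊤-stable (A ∨' B) [ B ] (λ { _ (∨L _ b) → b }) d (↭-shift Π σ) tt)
  (shifts [ B ] Π) refl
invert Π d (∧R₁ {A = A} {B} τ) = replaceR ⊤-stable (A ∧' B) [ A ] (λ { _ (∧R a _) → a }) d τ tt
invert Π d (∧R₂ {A = A} {B} τ) = replaceR ⊤-stable (A ∧' B) [ B ] (λ { _ (∧R _ b) → b }) d τ tt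
invert Π d (∨R {A = A} {B} τ)  = replaceR ⊤-stable (A ∨' B) (A ∷ B ∷ []) (λ { _ (∨R a) → a }) d τ tt

contract-atom : atom p ∷ Γ ⊢ Δ → Γ ↭ atom p ∷ Γ₀ → Γ ⊢ Δ
contract-atom {p} d σ = replaceL (∈-stable λ ()) (atom p) []
  (λ { k (ax τ) → ax p (proj₂ (∈⇒↭∷ k)) τ }) d refl (↭∷⇒∈ σ)

CutAdmissible : Formula → Set
CutAdmissible D = ∀ {Γ Δ} → Γ ⊢ D ∷ Δ → D ∷ Γ ⊢ Δ → Γ ⊢ Δ

cut-chain : CutAdmissible A → CutAdmissible B →
            Γ ⊢ A ∷ Δ → A ∷ Γ₁ ⊢ B ∷ Δ₁ → B ∷ Γ ⊢ Δ → Γ ++ Γ₁ ⊢ Δ ++ Δ₁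
cut-chain {A} {B} {Γ} {Δ} {Γ₁} {Δ₁} cutA cutB a ab b =
  cutB (cutA (exchange (weaken Γ₁ (B ∷ Δ₁) a) refl (prep A (shift B Δ Δ₁)))
             (exchange (weaken Γ Δ ab) (prep A (++-comm Γ₁ Γ)) (prep B (++-comm Δ₁ Δ))))
       (weaken Γ₁ Δ₁ b)

⇒LRN-premises-⇒R : CutAdmissible A → CutAdmissible B →
                   ⇒LRN-Premises E F A B → A ∷ [] ⊢ B ∷ [] → E ∷ [] ⊢ F ∷ []
⇒LRN-premises-⇒R cutA cutB (e₁ , e₂ , _ , _) ab = cut-chain cutA cutB e₁ ab (exchangeL e₂)

⇒LRN-premises-trans : CutAdmissible A → CutAdmissible B →
                      ⇒LRN-Premises E F A B → ⇒LRN-Premises A B C D → ⇒LRN-Premises E F C D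
⇒LRN-premises-trans cutA cutB (e₁ , e₂ , e₃ , e₄) (l₁ , l₂ , l₃ , l₄) =
    exchangeR (cut-chain cutA cutB e₁ (exchangeR l₁) (exchangeL e₂))
  , cut-chain cutA cutB e₁ l₂ (exchangeL e₂)
  , exchangeR (cut-chain cutA cutB l₃ (exchangeR e₃) (exchangeL l₄))
  , cut-chain cutA cutB l₃ e₄ (exchangeL l₄)

CutForSubformulas : Formula → Set
CutForSubformulas (atom _) = ⊤
CutForSubformulas ⊥'       = ⊤
CutForSubformulas (A ∧' B) = CutAdmissible A × CutAdmissible B
CutForSubformulas (A ∨' B) = CutAdmissible A × CutAdmissible B
CutForSubformulas (A ⇒' B) = CutAdmissible A × CutAdmissible B

cut-principal : ∀ D → CutForSubformulas D → RightPrincipal D Γ Δ → D ∷ Γ ⊢ Δ → Γ ⊢ Δ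
cut-principal (atom p) _ (ax σ) d = contract-atom d σ
cut-principal (A ∧' B) (cutA , cutB) (∧R a b) d =
  cutA a (cutB (weakenL A b) (exchangeL (invert [] d (∧L refl))))
cut-principal (A ∨' B) (cutA , cutB) (∨R ab) d =
  cutB (cutA ab (weakenR B (invert [] d (∨L₁ refl)))) (invert [] d (∨L₂ refl))
cut-principal (A ⇒' B) (cutA , cutB) (⇒R ab) d = replaceL ⊤-stable (A ⇒' B) []
  (λ { _ (⇒LRN τ es) → ⇒R τ (⇒LRN-premises-⇒R cutA cutB es ab) }) d refl tt
cut-principal (A ⇒' B) (cutA , cutB) (⇒LRN σ ls) d = replaceL (∈-stable λ ()) (A ⇒' B) []
  (λ { k (⇒LRN τ es) → ⇒LRN-intro (proj₂ (∈⇒↭∷ k)) τ (⇒LRN-premises-trans cutA cutB es ls) })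
  d refl (↭∷⇒∈ σ)

mutual
  cut : ∀ D → CutAdmissible D
  cut D d e = replaceR (λ P d′ → invert [ D ] d′ P) D []
    (λ d′ R → cut-principal D (cutForSubformulas D) R d′) d refl e

  cutForSubformulas : ∀ D → CutForSubformulas D
  cutForSubformulas (atom _) = tt
  cutForSubformulas ⊥'       = tt
  cutForSubformulas (A ∧' B) = cut A , cut B
  cutForSubformulas (A ∨' B) = cut A , cut B
  cutForSubformulas (A ⇒' B) = cut A , cut B

mainTheorem5 : (Γ Γ' Δ Δ' : List Formula) (D : Formula) →
    GWF_N Γ (D ∷ Δ) → GWF_N (D ∷ Γ') Δ' → GWF_N (Γ ++ Γ') (Δ ++ Δ')
mainTheorem5 Γ Γ' Δ Δ' D left right =
  cut D (weaken Γ' Δ' left) (exchange (weaken Γ Δ right) (prep D (++-comm Γ' Γ)) (++-comm Δ' Δ))
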